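{- Let $R \cong F_1 \times F_2 \times \cdots \times F_n$ with $n \ge 3$, where each $F_i$ is a finite field. Then the clique number of $\mathrm{PIS}(R)$ is $n$.
   Context: For a commutative ring $R$ with unity, the prime ideal sum graph $\mathrm{PIS}(R)$ is the simple undirected graph whose vertex set is the set of all nonzero proper ideals of $R$, with two distinct vertices $I$ and $J$ adjacent if and only if $I+J$ is a prime ideal of $R$. The clique number of a graph is the largest size of a set of pairwise adjacent vertices. -}

module Defs where

open import Level using (0ℓ)
open import Algebra.Bundles using (CommutativeRing)
open import Algebra.Bundles.Raw using (RawRing)
open import Data.Nat using (ℕ; _≤_)
open import Data.Fin using (Fin)
open import Data.List using (List; length)
open import Data.List.Relation.Unary.All using (All)
open import Data.List.Relation.Unary.AllPairs using (AllPairs)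
open import Data.Product using (Σ; ∃; _×_)
open import Data.Sum using (_⊎_)
open import Relation.Nullary using (¬_)
open import Relation.Binary.PropositionalEquality using (_≡_)

record Field : Set₁ where
  field
    commutativeRing : CommutativeRing 0ℓ 0ℓ
  open CommutativeRing commutativeRing public
  field
    1≉0     : ¬ (1# ≈ 0#)
    inverse : ∀ x → ¬ (x ≈ 0#) → Σ Carrier λ y → (x * y) ≈ 1#

record IsFinite (F : Field) : Set where
  open Field F
  field
    size      : ℕ
    enum      : Fin size → Carrier
    injective : ∀ i j → enum i ≈ enum j → i ≡ j
    surjective : ∀ x → Σ (Fin size) λ i → enum i ≈ x

ProductRawRing : ∀ {n} → (Fin n → Field) → RawRing 0ℓ 0ℓ
ProductRawRing {n} F = record
  { Carrier = (i : Fin n) → Field.Carrier (F i)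
  ; _≈_ = λ x y → ∀ i → Field._≈_ (F i) (x i) (y i)
  ; _+_ = λ x y i → Field._+_ (F i) (x i) (y i)
  ; _*_ = λ x y i → Field._*_ (F i) (x i) (y i)
  ; -_  = λ x i → Field.-_ (F i) (x i)
  ; 0#  = λ i → Field.0# (F i)
  ; 1#  = λ i → Field.1# (F i)
  }

module _ (R : CommutativeRing 0ℓ 0ℓ) where
  open CommutativeRing R

  record Ideal : Set₁ where
    field
      _∈I    : Carrier → Set
      resp   : ∀ {x y} → x ≈ y → x ∈I → y ∈I
      0∈     : 0# ∈I
      +-closed : ∀ {x y} → x ∈I → y ∈I → (x + y) ∈I
      *-closed : ∀ r {x} → x ∈I → (r * x) ∈I

  open Ideal public

  SameIdeal : Ideal → Ideal → Set
  SameIdeal I J = ∀ x → ((I ∈I) x → (J ∈I) x) × ((J ∈I) x → (I ∈I) x)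

  _∈Sum_,_ : Carrier → Ideal → Ideal → Set
  z ∈Sum I , J = ∃ λ x → ∃ λ y → (I ∈I) x × (J ∈I) y × (z ≈ (x + y))

  SumIsPrime : Ideal → Ideal → Set
  SumIsPrime I J = ¬ (1# ∈Sum I , J)
                 × (∀ a b → (a * b) ∈Sum I , J → (a ∈Sum I , J) ⊎ (b ∈Sum I , J))

  IsVertex : Ideal → Set
  IsVertex I = (∃ λ x → (I ∈I) x × ¬ (x ≈ 0#)) × ¬ ((I ∈I) 1#)

  Adjacent : Ideal → Ideal → Set
  Adjacent I J = ¬ SameIdeal I J × SumIsPrime I J

  -- A clique: a list of vertices that are pairwise adjacent (hence pairwise distinct).
  IsClique : List Ideal → Set₁
  IsClique L = All IsVertex L × AllPairs Adjacent L

  CliqueNumberIs : ℕ → Set₁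
  CliqueNumberIs m = (Σ (List Ideal) λ L → IsClique L × length L ≡ m)
                   × (∀ L → IsClique L → length L ≤ m)

-- An ideal of R ≅ F₁ × ⋯ × Fₙ is determined by which of the primitive idempotents
-- ε₁, …, εₙ it contains; call the remaining coordinates its zero set. The prime ideals
-- are exactly the ideals whose zero set is a single point, so I + J is prime iff the
-- zero sets of I and J meet in exactly one point. A clique therefore yields distinct
-- proper subsets of {1, …, n} pairwise meeting in exactly one point, and by the dual
-- de Bruijn–Erdős theorem there are at most n of them. Conversely, writing 𝔪ⱼ for the
-- maximal ideal of elements vanishing at j, the n ideals 𝔪₀ ∩ 𝔪ₐ pairwise sum to 𝔪₀,
-- and they are nonzero as soon as n ≥ 3. Finiteness of the fields is used only to
-- decide whether a coordinate vanishes.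
--
-- For the de Bruijn–Erdős bound: if some point lies on every set, the sets inject
-- into the points; otherwise a set A missing a point x has at least as many points
-- as there are sets through x, and a weighted double count over the non-incidences
-- rules out having more sets than points.
module Submission where

open import Defs
open import Level using (0ℓ)
open import Algebra.Bundles using (CommutativeRing)
open import Algebra.Morphism.Structures using (module RingMorphisms)
open import Data.Nat using (ℕ; _≤_)
open import Data.Fin using (Fin)

open import Algebra.Bundles using (CommutativeMonoid)
open import Data.Bool.Base using (Bool; true; false; not; T; _∧_)
open import Data.Fin.Base using (zero; suc; fromℕ<; punchIn)
open import Data.Nat.Base as ℕ using (z≤n; s≤s)
import Data.Nat.Properties as ℕ
open import Data.Product.Base as Product using (∃; _×_; _,_; proj₁; proj₂)
open import Data.Sum.Base using (_⊎_; inj₁; inj₂; [_,_])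
import Data.Sum.Base as Sum
open import Function.Base using (_∘_)
open import Relation.Binary.PropositionalEquality as ≡ using (_≡_; _≢_)
open import Relation.Nullary.Decidable
  using (Dec; yes; no; ¬?; T?; _×-dec_; ⌊_⌋; toWitness; fromWitness; decidable-stable; ¬¬-excluded-middle)
open import Relation.Nullary.Negation using (¬_; contradiction; ¬¬-map; ¬¬-Monad)
open import Relation.Unary using (_⊆_)
open import Relation.Binary.Core using (Rel)
open import Relation.Binary.Definitions using (Symmetric)
open import Data.List.Base using (lookup; _∷_)
open import Data.List.Membership.Propositional.Properties using (∈-lookup)
import Data.List.Relation.Unary.All as All
open import Data.List.Relation.Unary.AllPairs using (AllPairs; _∷_)
open import Data.Fin.Properties
  using ( _≟_; suc-injective; 0≢1+n; any?; all?; ¬∀⟶∃¬; injective⇒≤; punchInᵢ≢i; nonZeroIndex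
        ; ∀-cons; sequence)
open import Effect.Monad using (RawMonad)

module Counting where
  open import Data.Bool.Properties using (T-∧)
  open import Function.Bundles using (Equivalence)
  open import Algebra.Properties.Semiring.Sum ℕ.+-*-semiring
    using (sum; ∑-comm; sum-cong-≗; sum-replicate-zero)
  open import Data.Nat.Base using (_+_)
  open ≡ using (refl; sym; trans; cong; subst)

  𝟙 : Bool → ℕ
  𝟙 true  = 1
  𝟙 false = 0

  count : ∀ {k} → (Fin k → Bool) → ℕ
  count P = sum (𝟙 ∘ P)

  private
    ∑-mono-≤ : ∀ {k} {f g : Fin k → ℕ} → (∀ i → f i ≤ g i) → sum f ≤ sum g
    ∑-mono-≤ {ℕ.zero}  f≤g = z≤n
    ∑-mono-≤ {ℕ.suc k} f≤g = ℕ.+-mono-≤ (f≤g zero) (∑-mono-≤ (f≤g ∘ suc))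

  module _ {k} (P : Fin k → Bool) where

    count-zero : (∀ i → ¬ T (P i)) → count P ≡ 0
    count-zero ¬P = trans (sum-cong-≗ (λ i → 𝟙-false (¬P i))) (sum-replicate-zero k)
      where
      𝟙-false : ∀ {b} → ¬ T b → 𝟙 b ≡ 0
      𝟙-false {false} _  = refl
      𝟙-false {true}  ¬⊤ = contradiction _ ¬⊤

    count-pos : ∀ {i} → T (P i) → 1 ≤ count P
    count-pos {i} Pᵢ = ℕ.≤-trans (𝟙-true Pᵢ) (term≤sum i)
      where
      𝟙-true : ∀ {b} → T b → 1 ≤ 𝟙 b
      𝟙-true {true} _ = s≤s z≤n
      term≤sum : ∀ {l} {f : Fin l → ℕ} i → f i ≤ sum f
      term≤sum zero    = ℕ.m≤m+n _ _
      term≤sum (suc i) = ℕ.≤-trans (term≤sum i) (ℕ.m≤n+m _ _)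

  count-≤1 : ∀ {k} (P : Fin k → Bool) → (∀ {i j} → T (P i) → T (P j) → i ≡ j) → count P ≤ 1
  count-≤1 {ℕ.zero}  P unique = z≤n
  count-≤1 {ℕ.suc k} P unique with P zero | unique {zero}
  ... | true  | unique₀ = ℕ.≤-reflexive (cong ℕ.suc (count-zero (P ∘ suc) λ i Pᵢ → 0≢1+n (unique₀ _ Pᵢ)))
  ... | false | _       = count-≤1 (P ∘ suc) λ Pᵢ Pⱼ → suc-injective (unique Pᵢ Pⱼ)

  count-complement : ∀ {k} (P : Fin k → Bool) → count P + count (not ∘ P) ≡ k
  count-complement {ℕ.zero}  P = refl
  count-complement {ℕ.suc k} P with P zero
  ... | true  = cong ℕ.suc (count-complement (P ∘ suc))
  ... | false = trans (ℕ.+-suc _ _) (cong ℕ.suc (count-complement (P ∘ suc)))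

  count-singleton : ∀ {k} (i : Fin k) → count (λ j → ⌊ i ≟ j ⌋) ≡ 1
  count-singleton i = ℕ.≤-antisym
    (count-≤1 (λ j → ⌊ i ≟ j ⌋) λ i≡j i≡j′ → trans (sym (toWitness i≡j)) (toWitness i≡j′))
    (count-pos (λ j → ⌊ i ≟ j ⌋) (fromWitness refl))

  count-injection : ∀ {k l} (P : Fin k → Bool) (Q : Fin l → Bool) (f : Fin k → Fin l)
    → (∀ {i} → T (P i) → T (Q (f i)))
    → (∀ {i j} → T (P i) → T (P j) → f i ≡ f j → i ≡ j)
    → count P ≤ count Q
  count-injection {l = l} P Q f f-maps f-injective = begin
    count P                                      ≡⟨ sum-cong-≗ row ⟨
    sum (λ i → count (λ j → P i ∧ ⌊ f i ≟ j ⌋))  ≡⟨ ∑-comm (λ i j → 𝟙 (P i ∧ ⌊ f i ≟ j ⌋)) ⟩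
    sum (λ j → count (λ i → P i ∧ ⌊ f i ≟ j ⌋))  ≤⟨ ∑-mono-≤ column ⟩
    count Q                                      ∎
    where
    open ℕ.≤-Reasoning

    row : ∀ i → count (λ j → P i ∧ ⌊ f i ≟ j ⌋) ≡ 𝟙 (P i)
    row i with P i
    ... | true  = count-singleton (f i)
    ... | false = sum-replicate-zero l

    on-pair : ∀ {i j} → T (P i ∧ ⌊ f i ≟ j ⌋) → T (P i) × f i ≡ j
    on-pair = Product.map₂ toWitness ∘ Equivalence.to T-∧

    column : ∀ j → count (λ i → P i ∧ ⌊ f i ≟ j ⌋) ≤ 𝟙 (Q j)
    column j with Q j in Qⱼ
    ... | true  = count-≤1 (λ i → P i ∧ ⌊ f i ≟ j ⌋) λ p p′ →
                    let Pᵢ , fᵢ≡j = on-pair p; Pᵢ′ , fᵢ′≡j = on-pair p′ in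
                    f-injective Pᵢ Pᵢ′ (trans fᵢ≡j (sym fᵢ′≡j))
    ... | false = ℕ.≤-reflexive (count-zero (λ i → P i ∧ ⌊ f i ≟ j ⌋) λ i p →
                    let Pᵢ , fᵢ≡j = on-pair p in subst T (trans (cong Q fᵢ≡j) Qⱼ) (f-maps Pᵢ))

open Counting

module IncidenceWeights where
  open import Data.Integer.Base as ℤ using (+_)
  import Data.Integer.Properties as ℤ
  open import Data.Rational.Unnormalised.Base as ℚᵘ using (ℚᵘ; _/_; _≃_; *≡*; *<*; _+_; _*_)
  import Data.Rational.Unnormalised.Properties as ℚᵘ
  import Algebra.Properties.Semiring.Sum as SemiringSum
  open SemiringSum (CommutativeRing.semiring ℚᵘ.+-*-commutativeRing)
    using (sum; ∑-comm; *-distribʳ-sum; sum-cong-≋)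
  open SemiringSum ℕ.+-*-semiring using () renaming (sum to sumℕ)
  open ≡ using (cong; cong₂; subst₂; module ≡-Reasoning)

  ⟦_⟧ : ℕ → ℚᵘ
  ⟦ k ⟧ = + k / 1

  ⟦+⟧ : ∀ a b → ⟦ a ℕ.+ b ⟧ ≃ ⟦ a ⟧ + ⟦ b ⟧
  ⟦+⟧ a b = *≡* (cong (ℤ._* + 1) (begin
    + (a ℕ.+ b)                  ≡⟨ ℤ.pos-+ a b ⟩
    + a ℤ.+ + b                  ≡⟨ cong₂ ℤ._+_ (ℤ.*-identityʳ (+ a)) (ℤ.*-identityʳ (+ b)) ⟨
    + a ℤ.* + 1 ℤ.+ + b ℤ.* + 1  ∎))
    where open ≡-Reasoning

  ⟦∑⟧ : ∀ {k} (f : Fin k → ℕ) → ⟦ sumℕ f ⟧ ≃ sum (⟦_⟧ ∘ f)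
  ⟦∑⟧ {ℕ.zero}  f = ℚᵘ.≃-refl
  ⟦∑⟧ {ℕ.suc k} f = ℚᵘ.≃-trans (⟦+⟧ (f zero) _) (ℚᵘ.+-congʳ ⟦ f zero ⟧ (⟦∑⟧ (f ∘ suc)))

  ∑-const : ∀ k c → sum {k} (λ _ → ⟦ c ⟧) ≃ ⟦ k ℕ.* c ⟧
  ∑-const ℕ.zero    c = ℚᵘ.≃-refl
  ∑-const (ℕ.suc k) c = ℚᵘ.≃-trans (ℚᵘ.+-congʳ ⟦ c ⟧ (∑-const k c)) (ℚᵘ.≃-sym (⟦+⟧ c (k ℕ.* c)))

  ⟦⟧*/-cancel : ∀ p d .{{_ : ℕ.NonZero d}} → ⟦ d ⟧ * (+ p / d) ≃ ⟦ p ⟧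
  ⟦⟧*/-cancel p d@(ℕ.suc d-1) = *≡* (begin
    + d ℤ.* + p ℤ.* + 1   ≡⟨ ℤ.*-identityʳ _ ⟩
    + d ℤ.* + p           ≡⟨ ℤ.*-comm (+ d) (+ p) ⟩
    + p ℤ.* + d           ≡⟨ cong (λ k → + p ℤ.* + ℕ.suc k) (ℕ.+-identityʳ d-1) ⟨
    + p ℤ.* + (1 ℕ.* d)   ∎)
    where open ≡-Reasoning

  /-mono-< : ∀ p q a b .{{_ : ℕ.NonZero a}} .{{_ : ℕ.NonZero b}} →
             p ℕ.* a ℕ.< q ℕ.* b → + p / b ℚᵘ.< + q / a
  /-mono-< p q (ℕ.suc a) (ℕ.suc b) pa<qb =
    *<* (subst₂ ℤ._<_ (ℤ.pos-* p (ℕ.suc a)) (ℤ.pos-* q (ℕ.suc b)) (ℤ.+<+ pa<qb))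

  count-weighted : ∀ {k} (P : Fin k → Bool) w → sum (λ i → ⟦ 𝟙 (P i) ⟧ * w) ≃ ⟦ count P ⟧ * w
  count-weighted P w = ℚᵘ.≃-trans (ℚᵘ.≃-sym (*-distribʳ-sum w (⟦_⟧ ∘ 𝟙 ∘ P)))
                                  (ℚᵘ.*-congʳ (ℚᵘ.≃-sym (⟦∑⟧ (𝟙 ∘ P))))

  ∑-mono-≤ : ∀ {k} {f g : Fin k → ℚᵘ} → (∀ i → f i ℚᵘ.≤ g i) → sum f ℚᵘ.≤ sum g
  ∑-mono-≤ {ℕ.zero}  f≤g = ℚᵘ.≤-refl
  ∑-mono-≤ {ℕ.suc k} f≤g = ℚᵘ.+-mono-≤ (f≤g zero) (∑-mono-≤ (f≤g ∘ suc))

  ∑-mono-< : ∀ {k} {f g : Fin k → ℚᵘ} → (∀ i → f i ℚᵘ.≤ g i) → ∀ j → f j ℚᵘ.< g j → sum f ℚᵘ.< sum g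
  ∑-mono-< f≤g zero    f<g = ℚᵘ.+-mono-<-≤ f<g (∑-mono-≤ (f≤g ∘ suc))
  ∑-mono-< f≤g (suc j) f<g = ℚᵘ.+-mono-≤-< (f≤g zero) (∑-mono-< (f≤g ∘ suc) j f<g)

  𝟙-scale-< : ∀ {b p q} → T b → p ℚᵘ.< q → ⟦ 𝟙 b ⟧ * p ℚᵘ.< ⟦ 𝟙 b ⟧ * q
  𝟙-scale-< {true} {p} {q} _ p<q =
    ℚᵘ.<-respʳ-≃ (ℚᵘ.≃-sym (ℚᵘ.*-identityˡ q)) (ℚᵘ.<-respˡ-≃ (ℚᵘ.≃-sym (ℚᵘ.*-identityˡ p)) p<q)

  𝟙-scale-≤ : ∀ b {p q} → (T b → p ℚᵘ.< q) → ⟦ 𝟙 b ⟧ * p ℚᵘ.≤ ⟦ 𝟙 b ⟧ * q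
  𝟙-scale-≤ true          p<q = ℚᵘ.<⇒≤ (𝟙-scale-< _ (p<q _))
  𝟙-scale-≤ false {p} {q} _   = ℚᵘ.≤-reflexive (ℚᵘ.≃-trans (ℚᵘ.*-zeroˡ p) (ℚᵘ.≃-sym (ℚᵘ.*-zeroˡ q)))

  -- Weigh each incident pair (A , x) once by n / row A and once by m / column x:
  -- summing over x first, resp. over A first, both weightings have total m n.
  incidence-imbalance : ∀ {m n} (S : Fin m → Fin n → Bool) → Fin m
    → (∀ A → ∃ λ x → T (S A x)) → (∀ x → ∃ λ A → T (S A x))
    → ¬ (∀ {A x} → T (S A x) → m ℕ.* count (S A) ℕ.< n ℕ.* count (λ B → S B x))
  incidence-imbalance {m} {n} S A₀ rows columns ratio =
    ℚᵘ.<-irrefl (ℚᵘ.≃-reflexive (cong ⟦_⟧ (ℕ.*-comm n m))) (begin-strict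
      ⟦ n ℕ.* m ⟧                    ≃⟨ ∑-const n m ⟨
      sum {n} (λ x → ⟦ m ⟧)          ≃⟨ sum-cong-≋ column-total ⟨
      sum (λ x → sum (λ A → v A x))  ≃⟨ ∑-comm v ⟨
      sum (λ A → sum (λ x → v A x))  <⟨ ∑-mono-< (∑-mono-≤ ∘ v≤u) A₀ (∑-mono-< (v≤u A₀) x₀ (v<u Sx₀)) ⟩
      sum (λ A → sum (λ x → u A x))  ≃⟨ sum-cong-≋ row-total ⟩
      sum {m} (λ A → ⟦ n ⟧)          ≃⟨ ∑-const m n ⟩
      ⟦ m ℕ.* n ⟧                    ∎)
    where
    open ℚᵘ.≤-Reasoning

    row≢0 : ∀ A → ℕ.NonZero (count (S A))
    row≢0 A = ℕ.>-nonZero (count-pos (S A) (proj₂ (rows A)))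

    column≢0 : ∀ x → ℕ.NonZero (count (λ B → S B x))
    column≢0 x = ℕ.>-nonZero (count-pos (λ B → S B x) (proj₂ (columns x)))

    n/row : Fin m → ℚᵘ
    n/row A = _/_ (+ n) (count (S A)) {{row≢0 A}}

    m/column : Fin n → ℚᵘ
    m/column x = _/_ (+ m) (count (λ B → S B x)) {{column≢0 x}}

    u v : Fin m → Fin n → ℚᵘ
    u A x = ⟦ 𝟙 (S A x) ⟧ * n/row A
    v A x = ⟦ 𝟙 (S A x) ⟧ * m/column x

    row-total : ∀ A → sum (u A) ≃ ⟦ n ⟧
    row-total A = ℚᵘ.≃-trans (count-weighted (S A) (n/row A)) (⟦⟧*/-cancel n _ {{row≢0 A}})

    column-total : ∀ x → sum (λ A → v A x) ≃ ⟦ m ⟧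
    column-total x = ℚᵘ.≃-trans (count-weighted (λ A → S A x) (m/column x)) (⟦⟧*/-cancel m _ {{column≢0 x}})

    weights-< : ∀ {A x} → T (S A x) → m/column x ℚᵘ.< n/row A
    weights-< {A} {x} Sₓ = /-mono-< m n _ _ {{row≢0 A}} {{column≢0 x}} (ratio Sₓ)

    v≤u : ∀ A x → v A x ℚᵘ.≤ u A x
    v≤u A x = 𝟙-scale-≤ (S A x) weights-<

    v<u : ∀ {A x} → T (S A x) → v A x ℚᵘ.< u A x
    v<u Sₓ = 𝟙-scale-< Sₓ (weights-< Sₓ)

    x₀ = proj₁ (rows A₀)
    Sx₀ = proj₂ (rows A₀)

open IncidenceWeights using (incidence-imbalance)

module DeBruijnErdős where
  open import Data.Nat.Base using (_+_; _*_; _<_)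
  open ≡ using (sym; trans; cong; subst)

  complement-ratio-< : ∀ {m n k a r b} → k + a ≡ n → r + b ≡ m → r ≤ k → 1 ≤ k → n < m → m * a < n * b
  complement-ratio-< {m} {n} {k} {a} {r} {b} k+a≡n r+b≡m r≤k 1≤k n<m =
    ℕ.+-cancelʳ-< (m * k) (m * a) (n * b) (begin-strict
      m * a + m * k  ≡⟨ ℕ.*-distribˡ-+ m a k ⟨
      m * (a + k)    ≡⟨ cong (m *_) (trans (ℕ.+-comm a k) k+a≡n) ⟩
      m * n          ≡⟨ ℕ.*-comm m n ⟩
      n * m          ≡⟨ cong (n *_) (trans (sym r+b≡m) (ℕ.+-comm r b)) ⟩
      n * (b + r)    ≡⟨ ℕ.*-distribˡ-+ n b r ⟩
      n * b + n * r  <⟨ ℕ.+-monoʳ-< (n * b) nr<mk ⟩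
      n * b + m * k  ∎)
    where
    open ℕ.≤-Reasoning
    nr<mk = ℕ.≤-<-trans (ℕ.*-monoʳ-≤ n r≤k) (ℕ.*-monoˡ-< k {{ℕ.>-nonZero 1≤k}} n<m)

  record OnceIntersecting {m n} (C : Fin m → Fin n → Bool) : Set where
    field
      meet        : ∀ {A B} → A ≢ B → ∃ λ x → T (C A x) × T (C B x)
      meet-unique : ∀ {A B x y} → A ≢ B → T (C A x) → T (C B x) → T (C A y) → T (C B y) → x ≡ y
      injective   : ∀ {A B} → T ∘ C A ⊆ T ∘ C B → T ∘ C B ⊆ T ∘ C A → A ≡ B
      proper      : ∀ A → ∃ λ x → ¬ T (C A x)

  module _ {m n} {C : Fin m → Fin n → Bool} (family : OnceIntersecting C) where
    open OnceIntersecting family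

    joining-unique : ∀ {x y A B} → x ≢ y → T (C A x) → T (C A y) → T (C B x) → T (C B y) → A ≡ B
    joining-unique {A = A} {B} x≢y Aₓ A_y Bₓ B_y = decidable-stable (A ≟ B) λ A≢B →
      x≢y (meet-unique A≢B Aₓ Bₓ A_y B_y)

    pencil-≤-line : ∀ {x A} → ¬ T (C A x) → count (λ B → C B x) ≤ count (C A)
    pencil-≤-line {x} {A} x∉A =
      count-injection (λ B → C B x) (C A) meeting (proj₂ ∘ meeting-on) meeting-injective
      where
      meeting : Fin m → Fin n
      meeting B with B ≟ A
      ... | yes _   = x
      ... | no  B≢A = proj₁ (meet B≢A)

      meeting-on : ∀ {B} → T (C B x) → T (C B (meeting B)) × T (C A (meeting B))
      meeting-on {B} Bₓ with B ≟ A
      ... | yes ≡.refl = contradiction Bₓ x∉A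
      ... | no  B≢A    = proj₂ (meet B≢A)

      meeting-injective : ∀ {B B′} → T (C B x) → T (C B′ x) → meeting B ≡ meeting B′ → B ≡ B′
      meeting-injective {B} {B′} Bₓ B′ₓ same = joining-unique x≢p Bₓ (proj₁ (meeting-on Bₓ)) B′ₓ
        (subst (T ∘ C B′) (sym same) (proj₁ (meeting-on B′ₓ)))
        where
        x≢p : x ≢ meeting B
        x≢p x≡p = x∉A (subst (T ∘ C A) (sym x≡p) (proj₂ (meeting-on Bₓ)))

    concurrent-bound : ∀ x₀ → (∀ A → T (C A x₀)) → m ≤ n
    concurrent-bound x₀ through = injective⇒≤ λ {A} {B} → pick-injective (other? A) (other? B)
      where
      Other : Fin m → Set
      Other A = ∃ λ y → y ≢ x₀ × T (C A y)

      other? : ∀ A → Dec (Other A)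
      other? A = any? (λ y → ¬? (y ≟ x₀) ×-dec T? (C A y))

      pick : ∀ {A} → Dec (Other A) → Fin n
      pick (yes (y , _)) = y
      pick (no  _)       = x₀

      only-x₀ : ∀ {A} → ¬ Other A → T ∘ C A ⊆ (_≡ x₀)
      only-x₀ none {y} A_y = decidable-stable (y ≟ x₀) λ y≢x₀ → none (y , y≢x₀ , A_y)

      pick-injective : ∀ {A B} (a : Dec (Other A)) (b : Dec (Other B)) → pick a ≡ pick b → A ≡ B
      pick-injective {A} {B} (yes (y , y≢x₀ , A_y)) (yes (_ , _ , B_y)) ≡.refl =
        joining-unique (y≢x₀ ∘ sym) (through A) A_y (through B) B_y
      pick-injective (yes (_ , y≢x₀ , _)) (no _) y≡x₀ = contradiction y≡x₀ y≢x₀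
      pick-injective (no _) (yes (_ , y≢x₀ , _)) x₀≡y = contradiction (sym x₀≡y) y≢x₀
      pick-injective {A} {B} (no noneA) (no noneB) _ = injective
        (λ A_y → subst (T ∘ C B) (sym (only-x₀ noneA A_y)) (through B))
        (λ B_y → subst (T ∘ C A) (sym (only-x₀ noneB B_y)) (through A))

    nonconcurrent-bound : (∀ x → ∃ λ A → ¬ T (C A x)) → m ≤ n
    nonconcurrent-bound missed = decidable-stable (m ℕ.≤? n) λ m≰n →
      let n<m = ℕ.≰⇒> m≰n in
      incidence-imbalance (λ A x → not (C A x)) (fromℕ< n<m)
        (λ A → let x , x∉A = proper A in x , T-not x∉A)
        (λ x → let A , x∉A = missed x in A , T-not x∉A)
        (λ {A} {x} x∉A → complement-ratio-< (count-complement (C A)) (count-complement (λ B → C B x))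
                           (pencil-≤-line (T-not⁻ x∉A)) (line-nonempty n<m A) n<m)
      where
      T-not : ∀ {b} → ¬ T b → T (not b)
      T-not {false} _  = _
      T-not {true}  ¬⊤ = ¬⊤ _

      T-not⁻ : ∀ {b} → T (not b) → ¬ T b
      T-not⁻ {true} ()

      other-index : ∀ {k} → 1 < k → (i : Fin k) → ∃ λ j → j ≢ i
      other-index {ℕ.suc ℕ.zero}    (s≤s ())
      other-index {ℕ.suc (ℕ.suc _)} _ i = punchIn i zero , punchInᵢ≢i i zero

      line-nonempty : n < m → ∀ A → 1 ≤ count (C A)
      line-nonempty n<m A = count-pos (C A) (proj₁ (proj₂ (meet (proj₂ (other-index 1<m A) ∘ sym))))
        where 1<m = ℕ.≤-<-trans (ℕ.>-nonZero⁻¹ n {{nonZeroIndex (proj₁ (proper (fromℕ< n<m)))}}) n<m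

    de-Bruijn–Erdős : m ≤ n
    de-Bruijn–Erdős with any? (λ x → all? (λ A → T? (C A x)))
    ... | yes (x₀ , through) = concurrent-bound x₀ through
    ... | no  none           = nonconcurrent-bound λ x →
            ¬∀⟶∃¬ m (λ A → T (C A x)) (λ A → T? (C A x)) (λ through → none (x , through))

open DeBruijnErdős using (OnceIntersecting; de-Bruijn–Erdős)

∀-or-∃ : ∀ {k} {P Q : Fin k → Set} → (∀ i → P i ⊎ Q i) → (∀ i → P i) ⊎ ∃ Q
∀-or-∃ {ℕ.zero}  P⊎Q = inj₁ λ ()
∀-or-∃ {ℕ.suc k} P⊎Q with P⊎Q zero | ∀-or-∃ (P⊎Q ∘ suc)
... | inj₂ q₀ | _             = inj₂ (zero , q₀)
... | inj₁ p₀ | inj₁ ps       = inj₁ (∀-cons p₀ ps)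
... | inj₁ _  | inj₂ (i , qᵢ) = inj₂ (suc i , qᵢ)

¬¬-decidable : ∀ {k l} {P : Fin k → Fin l → Set} → ¬ ¬ (∀ a i → Dec (P a i))
¬¬-decidable = ¬¬-sequence λ a → ¬¬-sequence λ i → ¬¬-excluded-middle
  where ¬¬-sequence = sequence (RawMonad.rawApplicative ¬¬-Monad)

AllPairs-lookup : ∀ {a ℓ} {A : Set a} {∼ : Rel A ℓ} → Symmetric ∼ → ∀ {xs} → AllPairs ∼ xs →
                  ∀ {i j} → i ≢ j → ∼ (lookup xs i) (lookup xs j)
AllPairs-lookup sym (_  ∷ _)  {zero}  {zero}  i≢j = contradiction ≡.refl i≢j
AllPairs-lookup sym (px ∷ _)  {zero}  {suc j} _   = All.lookup px (∈-lookup j)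
AllPairs-lookup sym (px ∷ _)  {suc i} {zero}  _   = sym (All.lookup px (∈-lookup i))
AllPairs-lookup sym (_  ∷ ps) {suc i} {suc j} i≢j = AllPairs-lookup sym ps (i≢j ∘ ≡.cong suc)

module IdealTheory (R : CommutativeRing 0ℓ 0ℓ) where
  open CommutativeRing R hiding (zero)
  open import Algebra.Properties.Semiring.Sum semiring using (sum)
  open import Algebra.Properties.CommutativeSemigroup +-commutativeSemigroup using (interchange)

  IsPrimeIdeal : Ideal R → Set
  IsPrimeIdeal P = ¬ (P ∈I) 1# × (∀ a b → (P ∈I) (a * b) → (P ∈I) a ⊎ (P ∈I) b)

  _⊕_ : Ideal R → Ideal R → Ideal R
  I ⊕ J = record
    { _∈I      = λ z → _∈Sum_,_ R z I J
    ; resp     = λ { z≈w (x , y , x∈I , y∈J , z≈x+y) → x , y , x∈I , y∈J , trans (sym z≈w) z≈x+y }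
    ; 0∈       = 0# , 0# , 0∈ I , 0∈ J , sym (+-identityʳ 0#)
    ; +-closed = λ { (x , y , x∈I , y∈J , z≈x+y) (x′ , y′ , x′∈I , y′∈J , w≈x′+y′) →
                     x + x′ , y + y′ , +-closed I x∈I x′∈I , +-closed J y∈J y′∈J ,
                     trans (+-cong z≈x+y w≈x′+y′) (interchange x y x′ y′) }
    ; *-closed = λ { r (x , y , x∈I , y∈J , z≈x+y) →
                     r * x , r * y , *-closed I r x∈I , *-closed J r y∈J ,
                     trans (*-congˡ z≈x+y) (distribˡ r x y) }
    }

  _∩_ : Ideal R → Ideal R → Ideal R
  I ∩ J = record
    { _∈I      = λ z → (I ∈I) z × (J ∈I) z
    ; resp     = λ x≈y → Product.map (resp I x≈y) (resp J x≈y)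
    ; 0∈       = 0∈ I , 0∈ J
    ; +-closed = λ (x∈I , x∈J) (y∈I , y∈J) → +-closed I x∈I y∈I , +-closed J x∈J y∈J
    ; *-closed = λ r (x∈I , x∈J) → *-closed I r x∈I , *-closed J r x∈J
    }

  ∈⊕ˡ : ∀ I J {x} → (I ∈I) x → ((I ⊕ J) ∈I) x
  ∈⊕ˡ I J {x} x∈I = x , 0# , x∈I , 0∈ J , sym (+-identityʳ x)

  ∈⊕ʳ : ∀ I J {x} → (J ∈I) x → ((I ⊕ J) ∈I) x
  ∈⊕ʳ I J {x} x∈J = 0# , x , 0∈ I , x∈J , sym (+-identityˡ x)

  ⊕-comm : ∀ I J {z} → ((I ⊕ J) ∈I) z → ((J ⊕ I) ∈I) z
  ⊕-comm I J (x , y , x∈I , y∈J , z≈x+y) = y , x , y∈J , x∈I , trans z≈x+y (+-comm x y)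

  ∑-closed : ∀ (K : Ideal R) {k} (f : Fin k → Carrier) → (∀ i → (K ∈I) (f i)) → (K ∈I) (sum f)
  ∑-closed K {ℕ.zero}  f f∈K = 0∈ K
  ∑-closed K {ℕ.suc k} f f∈K = +-closed K (f∈K zero) (∑-closed K (f ∘ suc) (f∈K ∘ suc))

  prime-resp : ∀ P Q → SameIdeal R P Q → IsPrimeIdeal P → IsPrimeIdeal Q
  prime-resp P Q P≐Q (1∉P , prime) =
    1∉P ∘ proj₂ (P≐Q 1#) ,
    λ a b ab∈Q → Sum.map (proj₁ (P≐Q a)) (proj₁ (P≐Q b)) (prime a b (proj₂ (P≐Q (a * b)) ab∈Q))

  adjacent-sym : ∀ I J → Adjacent R I J → Adjacent R J I
  adjacent-sym I J (I≠J , 1∉I⊕J , prime) =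
    (λ J≐I → I≠J (Product.swap ∘ J≐I)) ,
    1∉I⊕J ∘ ⊕-comm J I ,
    λ a b ab∈J⊕I → Sum.map (⊕-comm I J) (⊕-comm I J) (prime a b (⊕-comm J I ab∈J⊕I))

module _ {c ℓ} (M : CommutativeMonoid c ℓ) where
  open CommutativeMonoid M
  open import Algebra.Properties.CommutativeMonoid.Sum M using (sum; sum-cong-≋; sum-replicate-zero)

  sum-single : ∀ {k} (t : Fin k → Carrier) j → (∀ i → i ≢ j → t i ≈ ε) → sum t ≈ t j
  sum-single {ℕ.suc k} t zero t≈ε =
    trans (∙-congˡ (trans (sum-cong-≋ (λ i → t≈ε (suc i) λ ())) (sum-replicate-zero k))) (identityʳ _)
  sum-single t (suc j) t≈ε = trans (∙-congʳ (t≈ε zero λ ()))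
    (trans (identityˡ _) (sum-single (t ∘ suc) j λ i i≢j → t≈ε (suc i) (i≢j ∘ suc-injective)))

module _ (F : Field) where
  open Field F

  IsFinite⇒decidable : IsFinite F → ∀ x y → Dec (x ≈ y)
  IsFinite⇒decidable finite x y with IsFinite.surjective finite x | IsFinite.surjective finite y
  ... | i , eᵢ≈x | j , eⱼ≈y with i ≟ j
  ... | yes ≡.refl = yes (trans (sym eᵢ≈x) eⱼ≈y)
  ... | no  i≢j    = no λ x≈y → i≢j (IsFinite.injective finite i j (trans eᵢ≈x (trans x≈y (sym eⱼ≈y))))

  zero-product : (∀ x → Dec (x ≈ 0#)) → ∀ x y → x * y ≈ 0# → x ≈ 0# ⊎ y ≈ 0#
  zero-product zero? x y xy≈0 with zero? x
  ... | yes x≈0 = inj₁ x≈0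
  ... | no  x≉0 = inj₂ (begin
    y              ≈⟨ *-identityˡ y ⟨
    1# * y         ≈⟨ *-congʳ (trans (*-comm x⁻¹ x) xx⁻¹≈1) ⟨
    (x⁻¹ * x) * y  ≈⟨ *-assoc x⁻¹ x y ⟩
    x⁻¹ * (x * y)  ≈⟨ *-congˡ xy≈0 ⟩
    x⁻¹ * 0#       ≈⟨ zeroʳ x⁻¹ ⟩
    0#             ∎)
    where
    open import Relation.Binary.Reasoning.Setoid setoid
    x⁻¹ = proj₁ (inverse x x≉0)
    xx⁻¹≈1 = proj₂ (inverse x x≉0)

module ProductOfFields {n} (F : Fin n → Field)
  (zero? : ∀ i x → Dec (Field._≈_ (F i) x (Field.0# (F i))))
  (R : CommutativeRing 0ℓ 0ℓ) {φ : CommutativeRing.Carrier R → (∀ i → Field.Carrier (F i))}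
  (iso : RingMorphisms.IsRingIsomorphism (CommutativeRing.rawRing R) (ProductRawRing F) φ) where

  open CommutativeRing R hiding (zero)
  open RingMorphisms.IsRingIsomorphism iso
  open IdealTheory R
  open import Algebra.Properties.Semiring.Sum semiring using (sum; *-distribʳ-sum)
  import Algebra.Properties.CommutativeMonoid.Sum as MonoidSum
  import Algebra.Properties.AbelianGroup as AbelianGroupProperties
  import Algebra.Properties.Group as GroupProperties
  import Relation.Binary.Reasoning.Setoid as SetoidReasoning
  open import Data.List.Base using (length; tabulate)
  open import Data.List.Properties using (length-tabulate)
  import Data.List.Relation.Unary.All.Properties as All
  import Data.List.Relation.Unary.AllPairs.Properties as AllPairs
  module 𝔽 (j : Fin n) = Field (F j)

  Coordinate : Fin n → Set
  Coordinate j = 𝔽.Carrier j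

  CoordinateEq : ∀ j → Coordinate j → Coordinate j → Set
  CoordinateEq j = 𝔽._≈_ j
  syntax CoordinateEq j x y = x ≈[ j ] y

  by-coordinates : ∀ {x y} → (∀ j → φ x j ≈[ j ] φ y j) → x ≈ y
  by-coordinates = injective

  ⌜_⌝ : (∀ j → Coordinate j) → Carrier
  ⌜ v ⌝ = proj₁ (surjective v)

  ⌜⌝-coordinate : ∀ v j → φ ⌜ v ⌝ j ≈[ j ] v j
  ⌜⌝-coordinate v = proj₂ (surjective v) refl

  single : ∀ i → Coordinate i → ∀ j → Coordinate j
  single i c j with i ≟ j
  ... | yes ≡.refl = c
  ... | no  _      = 𝔽.0# j

  single-diagonal : ∀ i c → single i c i ≈[ i ] c
  single-diagonal i c with i ≟ i
  ... | yes ≡.refl = 𝔽.refl i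
  ... | no  i≢i    = contradiction ≡.refl i≢i

  single-off : ∀ {i j} c → i ≢ j → single i c j ≈[ j ] 𝔽.0# j
  single-off {i} {j} c i≢j with i ≟ j
  ... | yes i≡j = contradiction i≡j i≢j
  ... | no  _   = 𝔽.refl j

  ε : Fin n → Carrier
  ε i = ⌜ single i (𝔽.1# i) ⌝

  ε-diagonal : ∀ i → φ (ε i) i ≈[ i ] 𝔽.1# i
  ε-diagonal i = 𝔽.trans i (⌜⌝-coordinate _ i) (single-diagonal i _)

  ε-off : ∀ {i j} → i ≢ j → φ (ε i) j ≈[ j ] 𝔽.0# j
  ε-off {j = j} i≢j = 𝔽.trans j (⌜⌝-coordinate _ j) (single-off _ i≢j)

  φ-sum : ∀ {k} (f : Fin k → Carrier) j →
          φ (sum f) j ≈[ j ] MonoidSum.sum (𝔽.+-commutativeMonoid j) (λ i → φ (f i) j)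
  φ-sum {ℕ.zero}  f j = 0#-homo j
  φ-sum {ℕ.suc k} f j = 𝔽.trans j (+-homo (f zero) _ j) (𝔽.+-congˡ j (φ-sum (f ∘ suc) j))

  ∑ε≈1 : sum ε ≈ 1#
  ∑ε≈1 = by-coordinates λ j → let open SetoidReasoning (𝔽.setoid j) in begin
    φ (sum ε) j                                                 ≈⟨ φ-sum ε j ⟩
    MonoidSum.sum (𝔽.+-commutativeMonoid j) (λ i → φ (ε i) j)  ≈⟨ sum-single (𝔽.+-commutativeMonoid j) _ j (λ _ → ε-off) ⟩
    φ (ε j) j                                                   ≈⟨ ε-diagonal j ⟩
    𝔽.1# j                                                      ≈⟨ 1#-homo j ⟨
    φ 1# j                                                      ∎

  decomposition : ∀ x → x ≈ sum (λ i → ε i * x)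
  decomposition x = begin
    x                    ≈⟨ *-identityˡ x ⟨
    1# * x               ≈⟨ *-congʳ ∑ε≈1 ⟨
    sum ε * x            ≈⟨ *-distribʳ-sum x ε ⟩
    sum (λ i → ε i * x)  ∎
    where open SetoidReasoning setoid

  ε*-vanishing : ∀ {i x} → φ x i ≈[ i ] 𝔽.0# i → ε i * x ≈ 0#
  ε*-vanishing {i} {x} xᵢ≈0 = by-coordinates λ j →
    𝔽.trans j (*-homo (ε i) x j) (𝔽.trans j (vanishes j) (𝔽.sym j (0#-homo j)))
    where
    vanishes : ∀ j → 𝔽._*_ j (φ (ε i) j) (φ x j) ≈[ j ] 𝔽.0# j
    vanishes j with i ≟ j
    ... | yes ≡.refl = 𝔽.trans i (𝔽.*-congˡ i xᵢ≈0) (𝔽.zeroʳ i _)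
    ... | no  i≢j    = 𝔽.trans j (𝔽.*-congʳ j (ε-off i≢j)) (𝔽.zeroˡ j _)

  ε*-unit : ∀ {i x} → φ x i ≈[ i ] 𝔽.1# i → ε i * x ≈ ε i
  ε*-unit {i} {x} xᵢ≈1 = by-coordinates λ j → 𝔽.trans j (*-homo (ε i) x j) (keeps j)
    where
    keeps : ∀ j → 𝔽._*_ j (φ (ε i) j) (φ x j) ≈[ j ] φ (ε i) j
    keeps j with i ≟ j
    ... | yes ≡.refl = 𝔽.trans i (𝔽.*-congˡ i xᵢ≈1) (𝔽.*-identityʳ i _)
    ... | no  i≢j    = 𝔽.trans j (𝔽.*-congʳ j (ε-off i≢j)) (𝔽.trans j (𝔽.zeroˡ j _) (𝔽.sym j (ε-off i≢j)))

  ∁ε : Fin n → Carrier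
  ∁ε k = 1# - ε k

  ε+∁ε≈1 : ∀ k → ε k + ∁ε k ≈ 1#
  ε+∁ε≈1 k = trans (sym (+-assoc (ε k) 1# (- ε k))) (xyx⁻¹≈y (ε k) 1#)
    where open AbelianGroupProperties +-abelianGroup using (xyx⁻¹≈y)

  ∁ε-coordinate : ∀ k j → φ (∁ε k) j ≈[ j ] 𝔽._-_ j (𝔽.1# j) (φ (ε k) j)
  ∁ε-coordinate k j = 𝔽.trans j (+-homo 1# (- ε k) j) (𝔽.+-cong j (1#-homo j) (-‿homo (ε k) j))

  ∁ε-diagonal : ∀ k → φ (∁ε k) k ≈[ k ] 𝔽.0# k
  ∁ε-diagonal k = 𝔽.trans k (∁ε-coordinate k k)
    (𝔽.trans k (𝔽.+-congˡ k (𝔽.-‿cong k (ε-diagonal k))) (𝔽.-‿inverseʳ k (𝔽.1# k)))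

  ∁ε-off : ∀ {k j} → k ≢ j → φ (∁ε k) j ≈[ j ] 𝔽.1# j
  ∁ε-off {k} {j} k≢j = 𝔽.trans j (∁ε-coordinate k j)
    (𝔽.trans j (𝔽.+-congˡ j (𝔽.trans j (𝔽.-‿cong j (ε-off k≢j)) ε⁻¹≈ε)) (𝔽.+-identityʳ j (𝔽.1# j)))
    where open GroupProperties (𝔽.+-group j) using (ε⁻¹≈ε)

  ε∈-if-coordinate≉0 : ∀ (K : Ideal R) {x} i → (K ∈I) x → ¬ φ x i ≈[ i ] 𝔽.0# i → (K ∈I) (ε i)
  ε∈-if-coordinate≉0 K {x} i x∈K xᵢ≉0 = resp K (by-coordinates agree) (*-closed K ⌜ single i c ⌝ x∈K)
    where
    c = proj₁ (𝔽.inverse i (φ x i) xᵢ≉0)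
    xᵢc≈1 = proj₂ (𝔽.inverse i (φ x i) xᵢ≉0)

    agree : ∀ j → φ (⌜ single i c ⌝ * x) j ≈[ j ] φ (ε i) j
    agree j = 𝔽.trans j (*-homo _ x j) (𝔽.trans j (𝔽.*-congʳ j (⌜⌝-coordinate _ j)) (on j))
      where
      on : ∀ j → 𝔽._*_ j (single i c j) (φ x j) ≈[ j ] φ (ε i) j
      on j with i ≟ j
      ... | yes ≡.refl = 𝔽.trans i (𝔽.*-comm i c (φ x i)) (𝔽.trans i xᵢc≈1 (𝔽.sym i (ε-diagonal i)))
      ... | no  i≢j    = 𝔽.trans j (𝔽.zeroˡ j _) (𝔽.sym j (ε-off i≢j))

  ∈-if-support-ε∈ : ∀ (K : Ideal R) {x} → (∀ i → ¬ φ x i ≈[ i ] 𝔽.0# i → (K ∈I) (ε i)) → (K ∈I) x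
  ∈-if-support-ε∈ K {x} support = resp K (sym (decomposition x)) (∑-closed K _ term∈K)
    where
    term∈K : ∀ i → (K ∈I) (ε i * x)
    term∈K i with zero? i (φ x i)
    ... | yes xᵢ≈0 = resp K (sym (ε*-vanishing xᵢ≈0)) (0∈ K)
    ... | no  xᵢ≉0 = resp K (*-comm x (ε i)) (*-closed K x (support i xᵢ≉0))

  ⊆-if-ε⊆ : ∀ I J → (∀ i → (I ∈I) (ε i) → (J ∈I) (ε i)) → ∀ {x} → (I ∈I) x → (J ∈I) x
  ⊆-if-ε⊆ I J ε⊆ x∈I = ∈-if-support-ε∈ J λ i xᵢ≉0 → ε⊆ i (ε∈-if-coordinate≉0 I i x∈I xᵢ≉0)

  ε∈⊕ : ∀ I J i → ((I ⊕ J) ∈I) (ε i) → (I ∈I) (ε i) ⊎ (J ∈I) (ε i)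
  ε∈⊕ I J i (a , b , a∈I , b∈J , εᵢ≈a+b) with zero? i (φ a i)
  ... | no  aᵢ≉0 = inj₁ (ε∈-if-coordinate≉0 I i a∈I aᵢ≉0)
  ... | yes aᵢ≈0 = inj₂ (ε∈-if-coordinate≉0 J i b∈J bᵢ≉0)
    where
    open SetoidReasoning (𝔽.setoid i)
    bᵢ≉0 : ¬ φ b i ≈[ i ] 𝔽.0# i
    bᵢ≉0 bᵢ≈0 = 𝔽.1≉0 i (begin
      𝔽.1# i                     ≈⟨ ε-diagonal i ⟨
      φ (ε i) i                  ≈⟨ ⟦⟧-cong εᵢ≈a+b i ⟩
      φ (a + b) i                ≈⟨ +-homo a b i ⟩
      𝔽._+_ i (φ a i) (φ b i)    ≈⟨ 𝔽.+-cong i aᵢ≈0 bᵢ≈0 ⟩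
      𝔽._+_ i (𝔽.0# i) (𝔽.0# i)  ≈⟨ 𝔽.+-identityʳ i _ ⟩
      𝔽.0# i                     ∎)

  prime-misses-one-ε : ∀ P → IsPrimeIdeal P → ∃ λ k → ¬ (P ∈I) (ε k) × (∀ i → i ≢ k → (P ∈I) (ε i))
  prime-misses-one-ε P (1∉P , prime)
    with ∀-or-∃ (λ k → prime (ε k) (∁ε k) (resp P (sym (ε*-vanishing (∁ε-diagonal k))) (0∈ P)))
  ... | inj₁ all-ε∈P   = contradiction (∈-if-support-ε∈ P λ i _ → all-ε∈P i) 1∉P
  ... | inj₂ (k , ∁εₖ∈P) =
    k , (λ εₖ∈P → 1∉P (resp P (ε+∁ε≈1 k) (+-closed P εₖ∈P ∁εₖ∈P))) ,
    λ i i≢k → resp P (ε*-unit (∁ε-off (i≢k ∘ ≡.sym))) (*-closed P (ε i) ∁εₖ∈P)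

  vertex-contains-ε : ∀ I → IsVertex R I → ∃ λ i → (I ∈I) (ε i)
  vertex-contains-ε I ((x , x∈I , x≉0) , _) with all? (λ j → zero? j (φ x j))
  ... | yes x≈0  = contradiction (by-coordinates λ j → 𝔽.trans j (x≈0 j) (𝔽.sym j (0#-homo j))) x≉0
  ... | no  x≉0′ = let i , xᵢ≉0 = ¬∀⟶∃¬ n _ (λ j → zero? j (φ x j)) x≉0′ in
                   i , ε∈-if-coordinate≉0 I i x∈I xᵢ≉0

  zero-sets-meet-once : ∀ I J → Adjacent R I J →
    ∃ λ k → (¬ (I ∈I) (ε k) × ¬ (J ∈I) (ε k)) × (∀ {i} → ¬ (I ∈I) (ε i) → ¬ (J ∈I) (ε i) → i ≡ k)
  zero-sets-meet-once I J (_ , I⊕J-prime) with prime-misses-one-ε (I ⊕ J) I⊕J-prime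
  ... | k , εₖ∉I⊕J , εᵢ∈I⊕J =
    k , (εₖ∉I⊕J ∘ ∈⊕ˡ I J , εₖ∉I⊕J ∘ ∈⊕ʳ I J) , λ {i} εᵢ∉I εᵢ∉J →
      decidable-stable (i ≟ k) λ i≢k → [ εᵢ∉I , εᵢ∉J ] (ε∈⊕ I J i (εᵢ∈I⊕J i i≢k))

  module _ {m} (I : Fin m → Ideal R) (vertex : ∀ a → IsVertex R (I a))
           (adjacent : ∀ {a b} → a ≢ b → Adjacent R (I a) (I b))
           (ε∈? : ∀ a i → Dec ((I a ∈I) (ε i))) where

    ZeroSet : Fin m → Fin n → Bool
    ZeroSet a i = ⌊ ¬? (ε∈? a i) ⌋

    ∉-if-ZeroSet : ∀ a i → T (ZeroSet a i) → ¬ (I a ∈I) (ε i)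
    ∉-if-ZeroSet a i = toWitness {a? = ¬? (ε∈? a i)}

    ZeroSet-if-∉ : ∀ a i → ¬ (I a ∈I) (ε i) → T (ZeroSet a i)
    ZeroSet-if-∉ a i = fromWitness {a? = ¬? (ε∈? a i)}

    zero-sets-onceIntersecting : OnceIntersecting ZeroSet
    zero-sets-onceIntersecting = record
      { meet        = λ {a} {b} a≢b →
          let k , (εₖ∉Iₐ , εₖ∉I_b) , _ = zero-sets-meet-once (I a) (I b) (adjacent a≢b) in
          k , ZeroSet-if-∉ a k εₖ∉Iₐ , ZeroSet-if-∉ b k εₖ∉I_b
      ; meet-unique = λ {a} {b} {x} {y} a≢b aₓ bₓ a_y b_y →
          let _ , _ , unique = zero-sets-meet-once (I a) (I b) (adjacent a≢b) in
          ≡.trans (unique (∉-if-ZeroSet a x aₓ) (∉-if-ZeroSet b x bₓ))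
                  (≡.sym (unique (∉-if-ZeroSet a y a_y) (∉-if-ZeroSet b y b_y)))
      ; injective   = zero-set-injective
      ; proper      = λ a → let i , εᵢ∈Iₐ = vertex-contains-ε (I a) (vertex a) in
                              i , λ aᵢ → ∉-if-ZeroSet a i aᵢ εᵢ∈Iₐ
      }
      where
      ε⊆ : ∀ {a b} → T ∘ ZeroSet b ⊆ T ∘ ZeroSet a → ∀ i → (I a ∈I) (ε i) → (I b ∈I) (ε i)
      ε⊆ {a} {b} Z_b⊆Zₐ i εᵢ∈Iₐ = decidable-stable (ε∈? b i) λ εᵢ∉I_b →
        ∉-if-ZeroSet a i (Z_b⊆Zₐ (ZeroSet-if-∉ b i εᵢ∉I_b)) εᵢ∈Iₐ

      zero-set-injective : ∀ {a b} → T ∘ ZeroSet a ⊆ T ∘ ZeroSet b → T ∘ ZeroSet b ⊆ T ∘ ZeroSet a →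
                           a ≡ b
      zero-set-injective {a} {b} Zₐ⊆Z_b Z_b⊆Zₐ = decidable-stable (a ≟ b) λ a≢b →
        proj₁ (adjacent a≢b) λ x → ⊆-if-ε⊆ (I a) (I b) (ε⊆ Z_b⊆Zₐ) , ⊆-if-ε⊆ (I b) (I a) (ε⊆ Zₐ⊆Z_b)

  -- Membership of εᵢ in an ideal need not be decidable, but the goal is, so it may be
  -- proved from decided memberships.
  clique-size≤n : ∀ L → IsClique R L → length L ≤ n
  clique-size≤n L (vertices , adjacents) = decidable-stable (length L ℕ.≤? n)
    (¬¬-map (de-Bruijn–Erdős ∘ zero-sets-onceIntersecting (lookup L) vertex adjacent)
            (¬¬-decidable {P = λ a i → (lookup L a ∈I) (ε i)}))
    where
    vertex : ∀ a → IsVertex R (lookup L a)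
    vertex a = All.lookup vertices (∈-lookup a)

    adjacent : ∀ {a b} → a ≢ b → Adjacent R (lookup L a) (lookup L b)
    adjacent = AllPairs-lookup (λ {I} {J} → adjacent-sym I J) adjacents

  𝔪 : Fin n → Ideal R
  𝔪 j = record
    { _∈I      = λ x → φ x j ≈[ j ] 𝔽.0# j
    ; resp     = λ x≈y xⱼ≈0 → 𝔽.trans j (⟦⟧-cong (sym x≈y) j) xⱼ≈0
    ; 0∈       = 0#-homo j
    ; +-closed = λ xⱼ≈0 yⱼ≈0 → 𝔽.trans j (+-homo _ _ j) (𝔽.trans j (𝔽.+-cong j xⱼ≈0 yⱼ≈0) (𝔽.+-identityʳ j _))
    ; *-closed = λ r xⱼ≈0 → 𝔽.trans j (*-homo r _ j) (𝔽.trans j (𝔽.*-congˡ j xⱼ≈0) (𝔽.zeroʳ j _))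
    }

  𝔪-prime : ∀ j → IsPrimeIdeal (𝔪 j)
  𝔪-prime j = (λ 1ⱼ≈0 → 𝔽.1≉0 j (𝔽.trans j (𝔽.sym j (1#-homo j)) 1ⱼ≈0)) ,
              λ a b abⱼ≈0 → zero-product (F j) (zero? j) _ _ (𝔽.trans j (𝔽.sym j (*-homo a b j)) abⱼ≈0)

  ε∉𝔪 : ∀ i → ¬ (𝔪 i ∈I) (ε i)
  ε∉𝔪 i εᵢ≈0 = 𝔽.1≉0 i (𝔽.trans i (𝔽.sym i (ε-diagonal i)) εᵢ≈0)

  ε≉0 : ∀ i → ¬ ε i ≈ 0#
  ε≉0 i ε≈0 = ε∉𝔪 i (resp (𝔪 i) (sym ε≈0) (0∈ (𝔪 i)))

  module _ (o : Fin n) where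

    V : Fin n → Ideal R
    V a = 𝔪 o ∩ 𝔪 a

    𝔪≐V⊕V : ∀ {a b} → a ≢ b → SameIdeal R (𝔪 o) (V a ⊕ V b)
    𝔪≐V⊕V {a} {b} a≢b x = split , merge
      where
      x≈ : x ≈ ∁ε a * x + ε a * x
      x≈ = begin
        x                   ≈⟨ *-identityˡ x ⟨
        1# * x              ≈⟨ *-congʳ (trans (+-comm (∁ε a) (ε a)) (ε+∁ε≈1 a)) ⟨
        (∁ε a + ε a) * x    ≈⟨ distribʳ x (∁ε a) (ε a) ⟩
        ∁ε a * x + ε a * x  ∎
        where open SetoidReasoning setoid

      split : (𝔪 o ∈I) x → ((V a ⊕ V b) ∈I) x
      split x∈𝔪ₒ = ∁ε a * x , ε a * x ,
        (*-closed (𝔪 o) (∁ε a) x∈𝔪ₒ , resp (𝔪 a) (*-comm x (∁ε a)) (*-closed (𝔪 a) x (∁ε-diagonal a))) ,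
        (*-closed (𝔪 o) (ε a) x∈𝔪ₒ , resp (𝔪 b) (*-comm x (ε a)) (*-closed (𝔪 b) x (ε-off a≢b))) ,
        x≈

      merge : ((V a ⊕ V b) ∈I) x → (𝔪 o ∈I) x
      merge (y , z , (y∈𝔪ₒ , _) , (z∈𝔪ₒ , _) , x≈y+z) = resp (𝔪 o) (sym x≈y+z) (+-closed (𝔪 o) y∈𝔪ₒ z∈𝔪ₒ)

    V-distinct : ∀ {a b} → a ≢ b → ¬ SameIdeal R (V a) (V b)
    V-distinct {a} {b} a≢b Vₐ≐V_b with b ≟ o
    ... | no  b≢o    = ε∉𝔪 b (proj₂ (proj₁ (Vₐ≐V_b (ε b)) (ε-off b≢o , ε-off (a≢b ∘ ≡.sym))))
    ... | yes ≡.refl = ε∉𝔪 a (proj₂ (proj₂ (Vₐ≐V_b (ε a)) (ε-off a≢b , ε-off a≢b)))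

    V-vertex : ∀ {a c} → c ≢ o → c ≢ a → IsVertex R (V a)
    V-vertex {c = c} c≢o c≢a =
      (ε c , (ε-off c≢o , ε-off c≢a) , ε≉0 c) , λ 1∈Vₐ → proj₁ (𝔪-prime o) (proj₁ 1∈Vₐ)

    V-adjacent : ∀ {a b} → a ≢ b → Adjacent R (V a) (V b)
    V-adjacent {a} {b} a≢b = V-distinct a≢b , prime-resp (𝔪 o) (V a ⊕ V b) (𝔪≐V⊕V a≢b) (𝔪-prime o)

    clique-of-size-n : (∀ a → ∃ λ c → c ≢ o × c ≢ a) → ∃ λ L → IsClique R L × length L ≡ n
    clique-of-size-n third =
      tabulate V ,
      (All.tabulate⁺ (λ a → let _ , c≢o , c≢a = third a in V-vertex c≢o c≢a) ,
       AllPairs.tabulate⁺ V-adjacent) ,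
      length-tabulate V

third-index : ∀ {k} (a : Fin (3 ℕ.+ k)) → ∃ λ c → c ≢ zero × c ≢ a
third-index zero          = suc zero       , (λ ()) , (λ ())
third-index (suc zero)    = suc (suc zero) , (λ ()) , (λ ())
third-index (suc (suc _)) = suc zero       , (λ ()) , (λ ())

lemma3p2 : (n : ℕ) → 3 ≤ n → (F : Fin n → Field) → (∀ i → IsFinite (F i))
    → (R : CommutativeRing 0ℓ 0ℓ)
    → (φ : CommutativeRing.Carrier R → ((i : Fin n) → Field.Carrier (F i)))
    → RingMorphisms.IsRingIsomorphism (CommutativeRing.rawRing R) (ProductRawRing F) φ
    → CliqueNumberIs R n
lemma3p2 n (s≤s (s≤s (s≤s _))) F finite R φ iso = clique-of-size-n zero third-index , clique-size≤n
  where
  open ProductOfFields F (λ i x → IsFinite⇒decidable (F i) (finite i) x (Field.0# (F i))) R iso
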